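{- Let $A$ be a graph with three distinct vertices $v_3,v_4,v_5$. Let $G$ be obtained from $A$ by adding a new vertex $c$ together with three edges $e=cv_4$, $x=cv_5$, $y=cv_3$ (so $c$ has no other incident edges), and assume $G$ is connected; equivalently $\Psi_G=(t_et_y+t_et_x+t_xt_y)\Psi_A+t_x\Psi_{A}^{(34)}+t_y\Psi_A^{(45)}+t_e\Psi_A^{(35)}$, where $\Psi_A^{(ij)}$ is the Kirchhoff polynomial of $A$ with $v_i$ and $v_j$ identified. If $1(G,e)$ holds, then $1(G/y,e)$ holds.
   Context: Graphs are finite multigraphs (parallel edges and self-loops allowed). To each edge $f$ assign a variable $t_f$. For a connected graph $G$ the Kirchhoff polynomial is $\Psi_G=\sum_{T}\prod_{f\notin T}t_f\in\mathbb{Q}[t_f: f\in E(G)]$, the sum over spanning trees $T$ of $G$; the Kirchhoff polynomial of a disconnected graph is $0$. $G\smallsetminus f$ denotes deletion and $G/f$ contraction of the edge $f$. For a connected graph $G$ and an edge $e$ of $G$, condition 1, written $1(G,e)$, is the statement that $\Psi_G$ lies in the ideal of $\mathbb{Q}[t_f:f\in E(G)]$ generated by the partial derivatives $\partial\Psi_{G\smallsetminus e}/\partial t_f$, $f\in E(G)$. -}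

module Defs where

open import Data.Nat as ℕ using (ℕ; zero; suc; _∸_)
open import Data.Bool using (Bool; true; false; _∨_; _∧_; if_then_else_; not; T)
open import Data.Fin using (Fin; zero; suc; punchIn; punchOut; _≟_)
open import Data.Fin.Properties using () renaming (_≟_ to _≟F_)
open import Data.Vec as Vec using (Vec; []; _∷_; lookup; insertAt; updateAt; tabulate; zipWith; replicate)
open import Data.Vec.Properties using (≡-dec)
open import Data.List as List using (List; []; _∷_; _++_; concatMap; allFin; foldr; filter)
open import Data.Bool.ListAction using (any; all)
import Data.Integer as ℤ
open import Data.Product using (_×_; _,_; proj₁; proj₂; Σ; ∃)
open import Data.Rational as ℚ using (ℚ; 0ℚ; 1ℚ)
open import Relation.Binary.PropositionalEquality using (_≡_; _≢_)
open import Relation.Nullary using (yes; no; does)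

-- Two polynomials are equal when every
-- monomial has the same (summed) coefficient.

Mono : ℕ → Set
Mono n = Vec ℕ n

Poly : ℕ → Set
Poly n = List (ℚ × Mono n)

coeff : ∀ {n} → Poly n → Mono n → ℚ
coeff []             m = 0ℚ
coeff ((c , m') ∷ p) m with ≡-dec ℕ._≟_ m' m
... | yes _ = c ℚ.+ coeff p m
... | no  _ = coeff p m

infix 4 _≈ₚ_
_≈ₚ_ : ∀ {n} → Poly n → Poly n → Set
p ≈ₚ q = ∀ m → coeff p m ≡ coeff q m

0ₚ : ∀ {n} → Poly n
0ₚ = []

_+ₚ_ : ∀ {n} → Poly n → Poly n → Poly n
p +ₚ q = p ++ q

_*ₚ_ : ∀ {n} → Poly n → Poly n → Poly n
p *ₚ q = concatMap (λ { (c , m) → List.map (λ { (d , m') → (c ℚ.* d , zipWith ℕ._+_ m m') }) q }) p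

Σₚ : ∀ {n k} → (Fin k → Poly n) → Poly n
Σₚ {k = k} f = foldr (λ i acc → f i +ₚ acc) 0ₚ (allFin k)

∂ : ∀ {n} → Fin n → Poly n → Poly n
∂ i = List.map (λ { (c , m) → (c ℚ.* (ℤ.+ (lookup m i) ℚ./ 1) , updateAt m i (λ k → k ∸ 1)) })

-- Regard a polynomial in the variables indexed by Fin n as one in the
-- variables indexed by Fin (suc n), via the renaming punchIn e (the
-- variable t_e does not occur).
embedAt : ∀ {n} → Fin (suc n) → Poly n → Poly (suc n)
embedAt e = List.map (λ { (c , m) → (c , insertAt m e 0) })

InIdeal : ∀ {n k} → Poly n → (Fin k → Poly n) → Set
InIdeal {n} p g = Σ (Fin _ → Poly n) λ q → p ≈ₚ Σₚ (λ i → q i *ₚ g i)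

-- Finite multigraphs: vertices Fin V, edges Fin E, each edge has an
-- (unordered, here recorded as a pair of) endpoints; loops and parallel
-- edges allowed.

record Graph (V E : ℕ) : Set where
  constructor graph
  field ends : Fin E → Fin V × Fin V
open Graph public

EdgeSet : ℕ → Set
EdgeSet E = Vec Bool E

allEdgeSets : ∀ E → List (EdgeSet E)
allEdgeSets zero    = [] ∷ []
allEdgeSets (suc E) = List.map (true ∷_) (allEdgeSets E) ++ List.map (false ∷_) (allEdgeSets E)

size : ∀ {E} → EdgeSet E → ℕ
size []          = 0
size (true ∷ s)  = suc (size s)
size (false ∷ s) = size s

_==_ : ∀ {V} → Fin V → Fin V → Bool
u == v = does (u ≟F v)

-- walkWithin G S k u v : there is a walk of length ≤ k from u to v
-- using only edges of S (edges traversed in either direction)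
walkWithin : ∀ {V E} → Graph V E → EdgeSet E → ℕ → Fin V → Fin V → Bool
walkWithin G S zero    u v = u == v
walkWithin {E = E} G S (suc k) u v =
  walkWithin G S k u v ∨
  any (λ f → lookup S f ∧
         (((proj₁ (ends G f) == u) ∧ walkWithin G S k (proj₂ (ends G f)) v) ∨
          ((proj₂ (ends G f) == u) ∧ walkWithin G S k (proj₁ (ends G f)) v)))
      (allFin E)

-- the spanning subgraph (V(G), S) is connected (walks of length ≤ V suffice)
connectedOn : ∀ {V E} → Graph V E → EdgeSet E → Bool
connectedOn {V} G S = all (λ u → all (λ v → walkWithin G S V u v) (allFin V)) (allFin V)

Connected : ∀ {V E} → Graph V E → Set
Connected {E = E} G = T (connectedOn G (replicate E true))

isSpanningTree : ∀ {V E} → Graph V E → EdgeSet E → Bool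
isSpanningTree {V} G S = connectedOn G S ∧ does (suc (size S) ℕ.≟ V)

-- Kirchhoff polynomial Ψ_G = Σ_T ∏_{f ∉ T} t_f (0 if there is no spanning tree)
Ψ : ∀ {V E} → Graph V E → Poly E
Ψ {E = E} G =
  List.map (λ S → (1ℚ , Vec.map (λ b → if b then 0 else 1) S))
           (filter (λ S → T? (isSpanningTree G S)) (allEdgeSets E))
  where
    open import Relation.Nullary using (Dec)
    open import Data.Bool.Properties using (T?)

_∖_ : ∀ {V m} → Graph V (suc m) → Fin (suc m) → Graph V m
G ∖ e = graph (λ f → ends G (punchIn e f))

-- identify b with a (a ≢ b) and renumber the remaining vertices
mergeV : ∀ {k} (a b : Fin (suc k)) → b ≢ a → Fin (suc k) → Fin k
mergeV a b b≢a w with w ≟F b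
... | yes _ = punchOut b≢a
... | no w≢b = punchOut {i = b} {j = w} (λ eq → w≢b (Relation.Binary.PropositionalEquality.sym eq))

_/_⟨_⟩ : ∀ {k m} (G : Graph (suc k) (suc m)) (e : Fin (suc m)) →
         proj₂ (ends G e) ≢ proj₁ (ends G e) → Graph k m
G / e ⟨ nl ⟩ = graph (λ f → let (u , v) = ends G (punchIn e f) in (q u , q v))
  where q = mergeV (proj₁ (ends G e)) (proj₂ (ends G e)) nl

-- condition 1(G,e): Ψ_G ∈ ⟨ ∂Ψ_{G∖e}/∂t_f : f ∈ E(G) ⟩ in ℚ[t_f : f ∈ E(G)]

Cond1 : ∀ {V m} → Graph V (suc m) → Fin (suc m) → Set
Cond1 G e = InIdeal (Ψ G) (λ f → ∂ f (embedAt e (Ψ (G ∖ e))))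

-- The graph G of the theorem: A plus a new vertex c (= zero, the vertices
-- of A being shifted by suc) and edges e = c v₄ (index 0), x = c v₅ (1),
-- y = c v₃ (2); the edges of A follow (index 3 + f).

attach3 : ∀ {V E} → Graph V E → (v₃ v₄ v₅ : Fin V) → Graph (suc V) (3 ℕ.+ E)
attach3 A v₃ v₄ v₅ = graph h
  where
    h : Fin (3 ℕ.+ _) → Fin (suc _) × Fin (suc _)
    h zero                   = (zero , suc v₄)
    h (suc zero)             = (zero , suc v₅)
    h (suc (suc zero))       = (zero , suc v₃)
    h (suc (suc (suc f)))    = (suc (proj₁ (ends A f)) , suc (proj₂ (ends A f)))

edge-e edge-x edge-y : ∀ {E} → Fin (3 ℕ.+ E)
edge-e = zero
edge-x = suc zero
edge-y = suc (suc zero)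

module Submission where

-- Write K = G ∖ e, H = G / y and L = H ∖ e; by construction L is K / y.
-- The proof substitutes t_y := 0 in a certificate for 1(G,e).
--   * Substitution is additive and multiplicative, commutes with ∂/∂t_f for
--     f ≠ y, and sends Ψ_M to Ψ_{M/y} for any non-loop edge y (spanning trees
--     of M / y are the spanning trees of M through y, with y contracted).
--   * Hence it sends each generator ∂Ψ_K/∂t_f (f ≠ y) of the ideal for G to
--     the generator ∂Ψ_L/∂t_f of the ideal for H, and Ψ_G to Ψ_H.
--   * In K the edges x and y are in series (the vertex c meets only them), so
--     every spanning tree of K contains x or y and exchanging x and y preserves
--     spanning trees; therefore ∂Ψ_K/∂t_y with t_y := 0 is ∂Ψ_L/∂t_x.
-- So Ψ_G = Σ_f q_f ∂Ψ_K/∂t_f becomes Ψ_H = Σ_f q_f|₀ ∂Ψ_L/∂t_f, with the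
-- cofactors of x and y merged.

open import Defs
open import Data.Nat as ℕ using (ℕ; zero; suc; _+_; _∸_; _≤_; z≤n; s≤s)
open import Data.Nat.Properties using (0≢1+n)
import Data.Nat.Properties as ℕP
open import Data.Bool using (Bool; true; false; _∨_; _∧_; T; if_then_else_)
open import Data.Bool.Properties using (T-∨; T-∧; T-≡; T?)
open import Data.Bool.ListAction using (all)
open import Data.Fin using (Fin; zero; suc; punchIn; punchOut)
open import Data.Fin.Properties
  using (punchOut-cong; punchOut-injective; punchIn-punchOut; punchOut-punchIn; punchInᵢ≢i)
  renaming (_≟_ to _≟F_)
open import Data.Fin.Subset using (Subset; ∣_∣) renaming (_∈_ to _∈ₛ_)
open import Data.Fin.Subset.Properties using (_∈?_; _⊂?_; p⊂q⇒∣p∣<∣q∣; ∣p∣≤n; x∈p⇒∣p-x∣<∣p∣)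
open import Data.Vec as Vec using (Vec; []; _∷_; lookup; insertAt; removeAt; updateAt; zipWith)
open import Data.Vec.Properties
  using (lookup∘tabulate; lookup⇒[]=; []=⇒lookup; insertAt-lookup; insertAt-punchIn; removeAt-insertAt;
         insertAt-removeAt; ≡-dec; ∷-injective;
         lookup∘updateAt; lookup∘updateAt′; lookup-zipWith; updateAt-updateAt; updateAt-id; updateAt-id-local)
open import Data.List as List using (List; []; _∷_; _++_; allFin)
import Data.List.Properties as LP
import Data.List.Relation.Unary.Any as Any
open import Data.List.Relation.Unary.Any using (satisfied)
import Data.List.Relation.Unary.All as All
open import Data.List.Relation.Unary.Any.Properties using (any⁺; any⁻)
open import Data.List.Relation.Unary.All.Properties using (all⁺; all⁻)
open import Data.List.Membership.Propositional.Properties using (∈-allFin)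
open import Data.Product using (_×_; _,_; proj₁; proj₂; Σ)
open import Data.Sum using (_⊎_; inj₁; inj₂; [_,_]′)
open import Data.Empty using (⊥; ⊥-elim)
open import Data.Unit using (tt)
open import Function using (_∘_; id; Equivalence)
import Data.Integer as ℤ
open import Data.Rational as ℚ using (ℚ; 0ℚ; 1ℚ)
import Data.Rational.Properties as ℚP
open import Algebra.Properties.Monoid.Sum ℚP.+-0-monoid using (sum; sum-cong-≗)
open import Relation.Nullary using (Dec; yes; no; does; ¬_)
open import Relation.Binary.PropositionalEquality
open import Relation.Binary.Construct.Closure.ReflexiveTransitive using (Star; ε; _◅_; _◅◅_)

T-ext : ∀ {a b} → (T a → T b) → (T b → T a) → a ≡ b
T-ext {true}  {true}  _ _ = refl
T-ext {true}  {false} f _ = ⊥-elim (f tt)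
T-ext {false} {true}  _ g = ⊥-elim (g tt)
T-ext {false} {false} _ _ = refl

==-sound : ∀ {n} {u v : Fin n} → T (u == v) → u ≡ v
==-sound {u = u} {v} t with u ≟F v
... | yes u≡v = u≡v

==-refl : ∀ {n} (u : Fin n) → T (u == u)
==-refl u with u ≟F u
... | yes _  = tt
... | no u≢u = u≢u refl

-- Stabilisation of a growing chain P₀ ⊆ P₁ ⊆ … of nonempty subsets of Fin n
-- which stays constant once it stops growing: every Pₖ is contained in Pₙ.
-- (Each strict step adds an element, and there is room for at most n.)
module Stabilise {n : ℕ} (P : ℕ → Fin n → Bool)
    (grows : ∀ k u → T (P k u) → T (P (suc k) u))
    (settles : ∀ k → (∀ u → T (P (suc k) u) → T (P k u)) →
                     ∀ u → T (P (suc (suc k)) u) → T (P (suc k) u))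
    (start : Fin n) (start∈P₀ : T (P 0 start)) where

  Stable : ℕ → Set
  Stable k = ∀ u → T (P (suc k) u) → T (P k u)

  set : ℕ → Subset n
  set k = Vec.tabulate (P k)

  ∈set : ∀ {k u} → T (P k u) → u ∈ₛ set k
  ∈set {k} {u} t = lookup⇒[]= u (set k) (trans (lookup∘tabulate (P k) u) (Equivalence.to T-≡ t))

  set∈ : ∀ {k u} → u ∈ₛ set k → T (P k u)
  set∈ {k} {u} u∈ = Equivalence.from T-≡ (trans (sym (lookup∘tabulate (P k) u)) ([]=⇒lookup u∈))

  grows+ : ∀ i k u → T (P k u) → T (P (i + k) u)
  grows+ zero    k u t = t
  grows+ (suc i) k u t = grows (i + k) u (grows+ i k u t)

  stays : ∀ j → Stable j → ∀ i → Stable (i + j)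
  stays j s zero    = s
  stays j s (suc i) = settles (i + j) (stays j s i)

  collapse : ∀ j → Stable j → ∀ i u → T (P (i + j) u) → T (P j u)
  collapse j s zero    u t = t
  collapse j s (suc i) u t = collapse j s i u (stays j s i u t)

  progress : ∀ k → (Σ ℕ λ j → j ≤ k × Stable j) ⊎ (suc k ≤ ∣ set k ∣)
  progress zero = inj₂ (ℕP.≤-trans (s≤s z≤n) (x∈p⇒∣p-x∣<∣p∣ (∈set start∈P₀)))
  progress (suc k) with progress k
  ... | inj₁ (j , j≤k , s) = inj₁ (j , ℕP.m≤n⇒m≤1+n j≤k , s)
  ... | inj₂ big with set k ⊂? set (suc k)
  ... | yes strict = inj₂ (ℕP.≤-trans (s≤s big) (p⊂q⇒∣p∣<∣q∣ strict))
  ... | no ¬strict = inj₁ (k , ℕP.n≤1+n k , stable)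
    where
      stable : Stable k
      stable u t with u ∈? set k
      ... | yes u∈ = set∈ u∈
      ... | no u∉ = ⊥-elim (¬strict ((λ x∈ → ∈set (grows k _ (set∈ x∈))) , u , ∈set t , u∉))

  saturate : ∀ k u → T (P k u) → T (P n u)
  saturate k u t with progress n
  ... | inj₂ big = ⊥-elim (ℕP.<-irrefl refl (ℕP.≤-trans big (∣p∣≤n (set n))))
  ... | inj₁ (j , j≤n , s) =
    subst (λ m → T (P m u)) (ℕP.m∸n+n≡m j≤n)
      (grows+ (n ∸ j) j u (collapse j s k u
        (subst (λ m → T (P m u)) (ℕP.+-comm j k) (grows+ j k u t))))

Joins : ∀ {V E} → Graph V E → Fin E → Fin V → Fin V → Set
Joins G f u w = (proj₁ (ends G f) ≡ u × proj₂ (ends G f) ≡ w)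
              ⊎ (proj₂ (ends G f) ≡ u × proj₁ (ends G f) ≡ w)

Edge : ∀ {V E} → Graph V E → EdgeSet E → Fin V → Fin V → Set
Edge {E = E} G S u w = Σ (Fin E) λ f → T (lookup S f) × Joins G f u w

Reach : ∀ {V E} → Graph V E → EdgeSet E → Fin V → Fin V → Set
Reach G S = Star (Edge G S)

Conn : ∀ {V E} → Graph V E → EdgeSet E → Set
Conn {V} G S = (u w : Fin V) → Reach G S u w

joins-sym : ∀ {V E} (G : Graph V E) {f u w} → Joins G f u w → Joins G f w u
joins-sym G (inj₁ (p , q)) = inj₂ (q , p)
joins-sym G (inj₂ (p , q)) = inj₁ (q , p)

reach-sym : ∀ {V E} (G : Graph V E) (S : EdgeSet E) {u w} → Reach G S u w → Reach G S w u
reach-sym G S ε                 = ε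
reach-sym G S ((f , s , j) ◅ r) = reach-sym G S r ◅◅ ((f , s , joins-sym G j) ◅ ε)

module Walks {V E : ℕ} (G : Graph V E) (S : EdgeSet E) where

  W : ℕ → Fin V → Fin V → Bool
  W = walkWithin G S

  step : ℕ → Fin V → Fin V → Fin E → Bool
  step k u v f = lookup S f ∧
    (((proj₁ (ends G f) == u) ∧ W k (proj₂ (ends G f)) v) ∨
     ((proj₂ (ends G f) == u) ∧ W k (proj₁ (ends G f)) v))

  split : ∀ k u v → T (W (suc k) u v) → T (W k u v) ⊎ (Σ (Fin V) λ w → Edge G S u w × T (W k w v))
  split k u v t with Equivalence.to T-∨ t
  ... | inj₁ shorter = inj₁ shorter
  ... | inj₂ found with satisfied (any⁻ (step k u v) (allFin E) found)
  ... | f , st with Equivalence.to T-∧ st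
  ... | s , t′ with Equivalence.to T-∨ t′
  ... | inj₁ l = let e , w = Equivalence.to T-∧ l in inj₂ (_ , (f , s , inj₁ (==-sound e , refl)) , w)
  ... | inj₂ r = let e , w = Equivalence.to T-∧ r in inj₂ (_ , (f , s , inj₂ (==-sound e , refl)) , w)

  extend : ∀ k {u w} v → Edge G S u w → T (W k w v) → T (W (suc k) u v)
  extend k {u} v (f , s , j) t =
    Equivalence.from T-∨ (inj₂ (any⁺ (step k u v) (Any.map (λ { refl → fires j t }) (∈-allFin f))))
    where
      sat : ∀ {u} → T ((proj₁ (ends G f) == u) ∧ W k (proj₂ (ends G f)) v)
                  ⊎ T ((proj₂ (ends G f) == u) ∧ W k (proj₁ (ends G f)) v) → T (step k u v f)
      sat h = Equivalence.from T-∧ (s , Equivalence.from T-∨ h)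
      fires : ∀ {u w} → Joins G f u w → T (W k w v) → T (step k u v f)
      fires (inj₁ (refl , refl)) t = sat (inj₁ (Equivalence.from T-∧ (==-refl (proj₁ (ends G f)) , t)))
      fires (inj₂ (refl , refl)) t = sat (inj₂ (Equivalence.from T-∧ (==-refl (proj₂ (ends G f)) , t)))

  walk⇒reach : ∀ k u v → T (W k u v) → Reach G S u v
  walk⇒reach zero    u v t = subst (Reach G S u) (==-sound t) ε
  walk⇒reach (suc k) u v t with split k u v t
  ... | inj₁ shorter         = walk⇒reach k u v shorter
  ... | inj₂ (w , uw , rest) = uw ◅ walk⇒reach k w v rest

  reach⇒walk : ∀ u v → Reach G S u v → Σ ℕ λ k → T (W k u v)
  reach⇒walk u .u ε        = 0 , ==-refl u
  reach⇒walk u v (uw ◅ r) = let k , t = reach⇒walk _ v r in suc k , extend k v uw t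

  -- Walks of length ≤ V suffice: the vertices reaching v within k steps form
  -- a chain of vertex sets which is constant once it stops growing.
  walk-shorten : ∀ k u v → T (W k u v) → T (W V u v)
  walk-shorten k u v = Stabilise.saturate (λ k u → W k u v) grows settles v (==-refl v) k u
    where
      grows : ∀ k u → T (W k u v) → T (W (suc k) u v)
      grows k u t = Equivalence.from T-∨ (inj₁ t)
      settles : ∀ k → (∀ u → T (W (suc k) u v) → T (W k u v)) →
                ∀ u → T (W (suc (suc k)) u v) → T (W (suc k) u v)
      settles k stable u t with split (suc k) u v t
      ... | inj₁ shorter         = shorter
      ... | inj₂ (w , uw , rest) = extend k v uw (stable w rest)

connectedOn⇒Conn : ∀ {V E} (G : Graph V E) (S : EdgeSet E) → T (connectedOn G S) → Conn G S
connectedOn⇒Conn {V} G S t u v = walk⇒reach V u v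
  (All.lookup (all⁺ (W V u) (allFin V) (All.lookup (all⁺ (λ u → all (W V u) (allFin V)) (allFin V) t)
                                                     (∈-allFin u)))
              (∈-allFin v))
  where open Walks G S

Conn⇒connectedOn : ∀ {V E} (G : Graph V E) (S : EdgeSet E) → Conn G S → T (connectedOn G S)
Conn⇒connectedOn {V} G S c =
  all⁻ (λ u → all (W V u) (allFin V)) {xs = allFin V} (All.tabulate λ {u} _ →
    all⁻ (W V u) {xs = allFin V} (All.tabulate λ {v} _ →
      let k , t = reach⇒walk u v (c u v) in walk-shorten k u v t))
  where open Walks G S

spanningTree-≡ : ∀ {V E E′} (G : Graph V E) (S : EdgeSet E) (G′ : Graph V E′) (S′ : EdgeSet E′) →
  (Conn G S → Conn G′ S′) → (Conn G′ S′ → Conn G S) → size S ≡ size S′ →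
  isSpanningTree G S ≡ isSpanningTree G′ S′
spanningTree-≡ {V} G S G′ S′ to from sizes = cong₂ _∧_
  (T-ext (Conn⇒connectedOn G′ S′ ∘ to ∘ connectedOn⇒Conn G S)
         (Conn⇒connectedOn G S ∘ from ∘ connectedOn⇒Conn G′ S′))
  (cong (λ s → does (suc s ℕ.≟ V)) sizes)

size-insert : ∀ {m} (S : EdgeSet m) (i : Fin (suc m)) → size (insertAt S i true) ≡ suc (size S)
size-insert S           zero    = refl
size-insert (true ∷ S)  (suc i) = cong suc (size-insert S i)
size-insert (false ∷ S) (suc i) = size-insert S i

module Contraction {k m : ℕ} (M : Graph (suc k) (suc m)) (y : Fin (suc m))
                   (nl : proj₂ (ends M y) ≢ proj₁ (ends M y)) (S′ : EdgeSet m) where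

  a b : Fin (suc k)
  a = proj₁ (ends M y)
  b = proj₂ (ends M y)

  q : Fin (suc k) → Fin k
  q = mergeV a b nl

  M′ : Graph k m
  M′ = M / y ⟨ nl ⟩

  S : EdgeSet (suc m)
  S = insertAt S′ y true

  -- S′ lives on the edges other than y: edge f′ of S′ is edge punchIn y f′ of S.
  inS : ∀ f′ → T (lookup S′ f′) → T (lookup S (punchIn y f′))
  inS f′ = subst T (sym (insertAt-punchIn S′ y true f′))

  q-b : q b ≡ punchOut nl
  q-b with b ≟F b
  ... | yes _ = refl
  ... | no b≢b = ⊥-elim (b≢b refl)

  q-other : ∀ w (w≢b : w ≢ b) → q w ≡ punchOut {i = b} {j = w} (w≢b ∘ sym)
  q-other w w≢b with w ≟F b
  ... | yes w≡b = ⊥-elim (w≢b w≡b)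
  ... | no _    = punchOut-cong b refl

  q-a≡q-b : q a ≡ q b
  q-a≡q-b = trans (q-other a (nl ∘ sym)) (trans (punchOut-cong b refl) (sym q-b))

  q-punchIn : ∀ z → q (punchIn b z) ≡ z
  q-punchIn z = trans (q-other (punchIn b z) (punchInᵢ≢i b z))
                      (trans (punchOut-cong b refl) (punchOut-punchIn b))

  y∈S : T (lookup S y)
  y∈S = subst T (sym (insertAt-lookup S′ y true)) tt

  fibre : ∀ u w → q u ≡ q w → Reach M S u w
  fibre u w qu≡qw = cases (u ≟F b) (w ≟F b)
    where
      yb : Edge M S a b
      yb = y , y∈S , inj₁ (refl , refl)
      cases : Dec (u ≡ b) → Dec (w ≡ b) → Reach M S u w
      cases (yes u≡b) (yes w≡b) = subst (Reach M S u) (trans u≡b (sym w≡b)) ε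
      cases (yes u≡b) (no w≢b) = subst₂ (Reach M S) (sym u≡b) a≡w (reach-sym M S (yb ◅ ε))
        where a≡w = punchOut-injective nl (w≢b ∘ sym)
                      (trans (sym q-b) (trans (cong q (sym u≡b)) (trans qu≡qw (q-other w w≢b))))
      cases (no u≢b) (yes w≡b) = subst₂ (Reach M S) a≡u (sym w≡b) (yb ◅ ε)
        where a≡u = punchOut-injective nl (u≢b ∘ sym)
                      (trans (sym q-b) (trans (cong q (sym w≡b)) (trans (sym qu≡qw) (q-other u u≢b))))
      cases (no u≢b) (no w≢b) = subst (Reach M S u) u≡w ε
        where u≡w = punchOut-injective (u≢b ∘ sym) (w≢b ∘ sym)
                      (trans (sym (q-other u u≢b)) (trans qu≡qw (q-other w w≢b)))

  project-edge : ∀ {u w} → Edge M S u w → Reach M′ S′ (q u) (q w)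
  project-edge {u} {w} (f , s , j) with f ≟F y
  ... | yes refl = subst (Reach M′ S′ (q u)) (qa≡qb j) ε
    where
      qa≡qb : Joins M y u w → q u ≡ q w
      qa≡qb (inj₁ (refl , refl)) = q-a≡q-b
      qa≡qb (inj₂ (refl , refl)) = sym q-a≡q-b
  ... | no f≢y = (f′ , s′ , image (subst (λ g → Joins M g u w) (sym f′↦f) j)) ◅ ε
    where
      f′ = punchOut (f≢y ∘ sym)
      f′↦f : punchIn y f′ ≡ f
      f′↦f = punchIn-punchOut (f≢y ∘ sym)
      s′ : T (lookup S′ f′)
      s′ = subst T (trans (cong (lookup S) (sym f′↦f)) (insertAt-punchIn S′ y true f′)) s
      image : Joins M (punchIn y f′) u w → Joins M′ f′ (q u) (q w)
      image (inj₁ (p , r)) = inj₁ (cong q p , cong q r)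
      image (inj₂ (p , r)) = inj₂ (cong q p , cong q r)

  project : ∀ {u w} → Reach M S u w → Reach M′ S′ (q u) (q w)
  project ε        = ε
  project (e ◅ r) = project-edge e ◅◅ project r

  lift : ∀ {z₁ z₂} → Reach M′ S′ z₁ z₂ → ∀ u w → q u ≡ z₁ → q w ≡ z₂ → Reach M S u w
  lift ε u w qu qw = fibre u w (trans qu (sym qw))
  lift ((f′ , s′ , j) ◅ r) u w qu qw with j
  ... | inj₁ (p , r′) = fibre u _ (trans qu (sym p))
                     ◅◅ ((punchIn y f′ , inS f′ s′ , inj₁ (refl , refl)) ◅ lift r _ w r′ qw)
  ... | inj₂ (p , r′) = fibre u _ (trans qu (sym p))
                     ◅◅ ((punchIn y f′ , inS f′ s′ , inj₂ (refl , refl)) ◅ lift r _ w r′ qw)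

  -- q is onto (via punchIn b), so both connectivities agree; sizes differ by y.
  spanningTree-contract : isSpanningTree M S ≡ isSpanningTree M′ S′
  spanningTree-contract = cong₂ _∧_
    (T-ext (λ t → Conn⇒connectedOn M′ S′ λ z₁ z₂ → subst₂ (Reach M′ S′) (q-punchIn z₁) (q-punchIn z₂)
                     (project (connectedOn⇒Conn M S t (punchIn b z₁) (punchIn b z₂))))
           (λ t → Conn⇒connectedOn M S λ u w → lift (connectedOn⇒Conn M′ S′ t (q u) (q w)) u w refl refl))
    (cong (λ s → does (suc s ℕ.≟ suc k)) (size-insert S′ y))

coeff-here : ∀ {n} c (m₁ m : Mono n) p → m₁ ≡ m → coeff ((c , m₁) ∷ p) m ≡ c ℚ.+ coeff p m
coeff-here c m₁ m p m₁≡m with ≡-dec ℕ._≟_ m₁ m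
... | yes _    = refl
... | no m₁≢m = ⊥-elim (m₁≢m m₁≡m)

coeff-there : ∀ {n} c (m₁ m : Mono n) p → m₁ ≢ m → coeff ((c , m₁) ∷ p) m ≡ coeff p m
coeff-there c m₁ m p m₁≢m with ≡-dec ℕ._≟_ m₁ m
... | yes m₁≡m = ⊥-elim (m₁≢m m₁≡m)
... | no _     = refl

coeff-++ : ∀ {n} (p q : Poly n) m → coeff (p ++ q) m ≡ coeff p m ℚ.+ coeff q m
coeff-++ []             q m = sym (ℚP.+-identityˡ _)
coeff-++ ((c , m₁) ∷ p) q m with ≡-dec ℕ._≟_ m₁ m
... | yes _ = trans (cong (c ℚ.+_) (coeff-++ p q m)) (sym (ℚP.+-assoc c _ _))
... | no _  = coeff-++ p q m

coeff-Σ : ∀ {n k} (f : Fin k → Poly n) m → coeff (Σₚ f) m ≡ sum (λ i → coeff (f i) m)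
coeff-Σ {k = k} f m = go k id
  where
    go : ∀ j (h : Fin j → Fin k) →
         coeff (List.foldr (λ i acc → f i +ₚ acc) 0ₚ (List.tabulate h)) m ≡ sum (λ i → coeff (f (h i)) m)
    go zero    h = refl
    go (suc j) h = trans (coeff-++ (f (h zero)) _ m) (cong (coeff (f (h zero)) m ℚ.+_) (go j (h ∘ suc)))

*-cons : ∀ {n} (t : ℚ × Mono n) p q → (t ∷ p) *ₚ q ≡ ((t ∷ []) *ₚ q) ++ (p *ₚ q)
*-cons t p q = cong (_++ (p *ₚ q)) (sym (LP.++-identityʳ _))

*-distribʳ-++ : ∀ {n} (p p′ q : Poly n) → (p ++ p′) *ₚ q ≡ (p *ₚ q) ++ (p′ *ₚ q)
*-distribʳ-++ p p′ q = LP.concatMap-++ _ p p′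

Divides : ∀ {n} → Mono n → Mono n → Set
Divides m₁ m = zipWith ℕ._+_ m₁ (zipWith _∸_ m m₁) ≡ m

quotient-unique : ∀ {n} (m₁ m′ m : Mono n) → zipWith ℕ._+_ m₁ m′ ≡ m → m′ ≡ zipWith _∸_ m m₁
quotient-unique []       []       []       _ = refl
quotient-unique (x ∷ m₁) (y ∷ m′) (z ∷ m) e =
  cong₂ _∷_ (trans (sym (ℕP.m+n∸m≡n x y)) (cong (_∸ x) (proj₁ (∷-injective e))))
            (quotient-unique m₁ m′ m (proj₂ (∷-injective e)))

coeff-term-* : ∀ {n} c (m₁ m : Mono n) X → Divides m₁ m →
               coeff (((c , m₁) ∷ []) *ₚ X) m ≡ c ℚ.* coeff X (zipWith _∸_ m m₁)
coeff-term-* c m₁ m []             d = sym (ℚP.*-zeroʳ c)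
coeff-term-* c m₁ m ((e , m′) ∷ X) d with ≡-dec ℕ._≟_ (zipWith ℕ._+_ m₁ m′) m
... | yes prod≡m = trans (cong (c ℚ.* e ℚ.+_) (coeff-term-* c m₁ m X d))
      (trans (sym (ℚP.*-distribˡ-+ c e _))
             (cong (c ℚ.*_) (sym (coeff-here e m′ _ X (quotient-unique m₁ m′ m prod≡m)))))
... | no prod≢m = trans (coeff-term-* c m₁ m X d)
      (cong (c ℚ.*_) (sym (coeff-there e m′ _ X (λ m′≡ → prod≢m (trans (cong (zipWith ℕ._+_ m₁) m′≡) d)))))

coeff-term-*-∤ : ∀ {n} c (m₁ m : Mono n) X → ¬ Divides m₁ m → coeff (((c , m₁) ∷ []) *ₚ X) m ≡ 0ℚ
coeff-term-*-∤ c m₁ m []             ∤ = refl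
coeff-term-*-∤ c m₁ m ((e , m′) ∷ X) ∤ =
  trans (coeff-there (c ℚ.* e) (zipWith ℕ._+_ m₁ m′) m _
           (λ prod≡m → ∤ (subst (λ z → zipWith ℕ._+_ m₁ z ≡ m) (quotient-unique m₁ m′ m prod≡m) prod≡m)))
        (coeff-term-*-∤ c m₁ m X ∤)

*-congˡ : ∀ {n} (P : Poly n) {X Y : Poly n} → X ≈ₚ Y → P *ₚ X ≈ₚ P *ₚ Y
*-congˡ []             X≈Y m = refl
*-congˡ ((c , m₁) ∷ P) {X} {Y} X≈Y m = begin
  coeff (((c , m₁) ∷ P) *ₚ X) m
    ≡⟨ cong (λ z → coeff z m) (*-cons (c , m₁) P X) ⟩
  coeff (t *ₚ X ++ P *ₚ X) m
    ≡⟨ coeff-++ (t *ₚ X) _ m ⟩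
  coeff (t *ₚ X) m ℚ.+ coeff (P *ₚ X) m
    ≡⟨ cong₂ ℚ._+_ (head-term (≡-dec ℕ._≟_ _ m)) (*-congˡ P X≈Y m) ⟩
  coeff (t *ₚ Y) m ℚ.+ coeff (P *ₚ Y) m
    ≡⟨ sym (coeff-++ (t *ₚ Y) _ m) ⟩
  coeff (t *ₚ Y ++ P *ₚ Y) m
    ≡⟨ cong (λ z → coeff z m) (sym (*-cons (c , m₁) P Y)) ⟩
  coeff (((c , m₁) ∷ P) *ₚ Y) m ∎
  where
    open ≡-Reasoning
    t = (c , m₁) ∷ []
    head-term : Dec (Divides m₁ m) → coeff (t *ₚ X) m ≡ coeff (t *ₚ Y) m
    head-term (yes d) = trans (coeff-term-* c m₁ m X d)
                              (trans (cong (c ℚ.*_) (X≈Y _)) (sym (coeff-term-* c m₁ m Y d)))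
    head-term (no ∤)  = trans (coeff-term-*-∤ c m₁ m X ∤) (sym (coeff-term-*-∤ c m₁ m Y ∤))

fromℕ : ℕ → ℚ
fromℕ k = ℤ.+ k ℚ./ 1

lower : ℕ → ℕ
lower k = k ∸ 1

lower-raise : ∀ {n} (i : Fin n) (m : Mono n) → updateAt (updateAt m i suc) i lower ≡ m
lower-raise i m = trans (updateAt-updateAt i m) (updateAt-id i m)

raise-lower : ∀ {n} (i : Fin n) (m′ : Mono n) {k} → lookup m′ i ≡ suc k →
              updateAt (updateAt m′ i lower) i suc ≡ m′
raise-lower i m′ m′ᵢ = trans (updateAt-updateAt i m′)
  (updateAt-id-local i {λ k → ℕ.suc (lower k)} m′ (trans (cong (λ k → ℕ.suc (lower k)) m′ᵢ) (sym m′ᵢ)))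

coeff-∂ : ∀ {n} (i : Fin n) (p : Poly n) m →
          coeff (∂ i p) m ≡ coeff p (updateAt m i suc) ℚ.* fromℕ (suc (lookup m i))
coeff-∂ i []              m = sym (ℚP.*-zeroˡ (fromℕ (suc (lookup m i))))
coeff-∂ i ((c , m′) ∷ p) m = go (lookup m′ i) refl (≡-dec ℕ._≟_ (updateAt m′ i lower) m)
  where
    F = fromℕ (suc (lookup m i))
    U = updateAt m i suc
    IH = coeff-∂ i p m
    c′ = c ℚ.* fromℕ (lookup m′ i)
    -- split on the tᵢ-exponent k of the head term and on whether lowering it gives m;
    -- for k = 0 the head term contributes nothing on either side
    go : ∀ k → lookup m′ i ≡ k → Dec (updateAt m′ i lower ≡ m) →
         coeff (∂ i ((c , m′) ∷ p)) m ≡ coeff ((c , m′) ∷ p) U ℚ.* F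
    go zero m′ᵢ d = trans (drop d) (trans IH (cong (ℚ._* F) (sym (coeff-there c m′ U p m′≢U))))
      where
        m′≢U : m′ ≢ U
        m′≢U eq = 0≢1+n (trans (sym m′ᵢ) (trans (cong (λ v → lookup v i) eq) (lookup∘updateAt i m)))
        drop : Dec (updateAt m′ i lower ≡ m) → coeff (∂ i ((c , m′) ∷ p)) m ≡ coeff (∂ i p) m
        drop (yes eq) = trans (coeff-here c′ _ m (∂ i p) eq)
          (trans (cong (λ z → c ℚ.* fromℕ z ℚ.+ coeff (∂ i p) m) m′ᵢ)
                 (trans (cong (ℚ._+ coeff (∂ i p) m) (ℚP.*-zeroʳ c)) (ℚP.+-identityˡ _)))
        drop (no ne)  = coeff-there c′ _ m (∂ i p) ne
    go (suc k) m′ᵢ (yes lowered) = begin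
      coeff (∂ i ((c , m′) ∷ p)) m             ≡⟨ coeff-here c′ _ m (∂ i p) lowered ⟩
      c′ ℚ.+ coeff (∂ i p) m                    ≡⟨ cong₂ ℚ._+_ (cong (λ z → c ℚ.* fromℕ z) m′ᵢ≡) IH ⟩
      c ℚ.* F ℚ.+ coeff p U ℚ.* F              ≡⟨ sym (ℚP.*-distribʳ-+ F c (coeff p U)) ⟩
      (c ℚ.+ coeff p U) ℚ.* F                  ≡⟨ cong (ℚ._* F) (sym (coeff-here c m′ U p m′≡U)) ⟩
      coeff ((c , m′) ∷ p) U ℚ.* F             ∎
      where
        open ≡-Reasoning
        m′≡U : m′ ≡ U
        m′≡U = trans (sym (raise-lower i m′ m′ᵢ)) (cong (λ v → updateAt v i suc) lowered)
        m′ᵢ≡ : lookup m′ i ≡ suc (lookup m i)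
        m′ᵢ≡ = trans m′ᵢ (cong suc (trans (cong lower (sym m′ᵢ))
                     (trans (sym (lookup∘updateAt i m′)) (cong (λ v → lookup v i) lowered))))
    go (suc k) m′ᵢ (no ¬lowered) = trans (coeff-there c′ _ m (∂ i p) ¬lowered)
      (trans IH (cong (ℚ._* F) (sym (coeff-there c m′ U p
        (λ eq → ¬lowered (trans (cong (λ v → updateAt v i lower) eq) (lower-raise i m)))))))

coeff-embedAt : ∀ {n} (i : Fin (suc n)) (P : Poly n) m → coeff (embedAt i P) (insertAt m i 0) ≡ coeff P m
coeff-embedAt i []              m = refl
coeff-embedAt i ((c , m′) ∷ P) m with ≡-dec ℕ._≟_ m′ m
... | yes m′≡m = trans (coeff-here c _ _ _ (cong (λ v → insertAt v i 0) m′≡m))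
                      (cong (c ℚ.+_) (coeff-embedAt i P m))
... | no m′≢m = trans (coeff-there c _ _ _ (λ eq → m′≢m (insertAt-injective i m′ m eq))) (coeff-embedAt i P m)
  where
    insertAt-injective : ∀ i (m′ m : Mono _) → insertAt m′ i 0 ≡ insertAt m i 0 → m′ ≡ m
    insertAt-injective i m′ m eq =
      trans (sym (removeAt-insertAt m′ i 0)) (trans (cong (λ v → removeAt v i) eq) (removeAt-insertAt m i 0))

coeff-embedAt-tᵢ : ∀ {n} (i : Fin (suc n)) (P : Poly n) m k → coeff (embedAt i P) (insertAt m i (suc k)) ≡ 0ℚ
coeff-embedAt-tᵢ i []              m k = refl
coeff-embedAt-tᵢ i ((c , m′) ∷ P) m k = trans
  (coeff-there c (insertAt m′ i 0) (insertAt m i (suc k)) (embedAt i P) λ eq →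
     0≢1+n (trans (sym (insertAt-lookup m′ i 0)) (trans (cong (λ v → lookup v i) eq) (insertAt-lookup m i (suc k)))))
  (coeff-embedAt-tᵢ i P m k)

embedAt-cong : ∀ {n} (i : Fin (suc n)) (P Q : Poly n) → P ≈ₚ Q → embedAt i P ≈ₚ embedAt i Q
embedAt-cong i P Q P≈Q m = subst (λ v → coeff (embedAt i P) v ≡ coeff (embedAt i Q) v)
  (insertAt-removeAt m i) (split (lookup m i))
  where
    split : ∀ k → coeff (embedAt i P) (insertAt (removeAt m i) i k)
                ≡ coeff (embedAt i Q) (insertAt (removeAt m i) i k)
    split zero    = trans (coeff-embedAt i P _) (trans (P≈Q _) (sym (coeff-embedAt i Q _)))
    split (suc k) = trans (coeff-embedAt-tᵢ i P _ k) (sym (coeff-embedAt-tᵢ i Q _ k))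

∂-cong : ∀ {n} (i : Fin n) (P Q : Poly n) → P ≈ₚ Q → ∂ i P ≈ₚ ∂ i Q
∂-cong i P Q P≈Q m = trans (coeff-∂ i P m) (trans (cong (ℚ._* _) (P≈Q _)) (sym (coeff-∂ i Q m)))

∂-embedAt₀ : ∀ {n} (f : Fin n) (P : Poly n) → ∂ (suc f) (embedAt zero P) ≡ embedAt zero (∂ f P)
∂-embedAt₀ f []      = refl
∂-embedAt₀ f (t ∷ P) = cong (_ ∷_) (∂-embedAt₀ f P)

keepIfZero : ∀ {n} → ℕ → ℚ × Mono n → Poly n → Poly n
keepIfZero zero    t p = t ∷ p
keepIfZero (suc _) t p = p

substZero : ∀ {n} → Fin (suc n) → Poly (suc n) → Poly n
substZero i []             = []
substZero i ((c , m) ∷ p) = keepIfZero (lookup m i) (c , removeAt m i) (substZero i p)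

removeAt-zipWith : ∀ {n} (f : ℕ → ℕ → ℕ) (xs ys : Vec ℕ (suc n)) i →
                   removeAt (zipWith f xs ys) i ≡ zipWith f (removeAt xs i) (removeAt ys i)
removeAt-zipWith f (x ∷ xs)          (y ∷ ys)          zero    = refl
removeAt-zipWith f (x ∷ xs@(_ ∷ _)) (y ∷ ys@(_ ∷ _)) (suc i) = cong (f x y ∷_) (removeAt-zipWith f xs ys i)

removeAt-updateAt : ∀ {n} (xs : Vec ℕ (suc n)) i j (g : ℕ → ℕ) →
                    removeAt (updateAt xs (punchIn i j) g) i ≡ updateAt (removeAt xs i) j g
removeAt-updateAt (x ∷ xs)          zero    j       g = refl
removeAt-updateAt (x ∷ xs@(_ ∷ _)) (suc i) zero    g = refl
removeAt-updateAt (x ∷ xs@(_ ∷ _)) (suc i) (suc j) g =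
  trans (removeAt-suc x (updateAt xs (punchIn i j) g) i) (cong (x ∷_) (removeAt-updateAt xs i j g))
  where
    removeAt-suc : ∀ {n} x (ys : Vec ℕ (suc n)) i → removeAt (x ∷ ys) (suc i) ≡ x ∷ removeAt ys i
    removeAt-suc x (_ ∷ _) i = refl

lookup-removeAt : ∀ {n} (xs : Vec ℕ (suc n)) i j → lookup (removeAt xs i) j ≡ lookup xs (punchIn i j)
lookup-removeAt (x ∷ xs)          zero    j       = refl
lookup-removeAt (x ∷ xs@(_ ∷ _)) (suc i) zero    = refl
lookup-removeAt (x ∷ xs@(_ ∷ _)) (suc i) (suc j) = lookup-removeAt xs i j

coeff-substZero : ∀ {n} (i : Fin (suc n)) (p : Poly (suc n)) m →
                  coeff (substZero i p) m ≡ coeff p (insertAt m i 0)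
coeff-substZero i []              m = refl
coeff-substZero i ((c , m′) ∷ p) m with lookup m′ i in m′ᵢ
... | suc k = trans (coeff-substZero i p m) (sym (coeff-there c m′ _ p λ eq →
        0≢1+n (trans (sym (insertAt-lookup m i 0)) (trans (cong (λ v → lookup v i) (sym eq)) m′ᵢ))))
... | zero with ≡-dec ℕ._≟_ (removeAt m′ i) m
...   | yes m′₋≡m = trans (cong (c ℚ.+_) (coeff-substZero i p m)) (sym (coeff-here c m′ _ p m′≡))
  where m′≡ = trans (sym (insertAt-removeAt m′ i)) (cong₂ (λ v z → insertAt v i z) m′₋≡m m′ᵢ)
...   | no m′₋≢m  = trans (coeff-substZero i p m) (sym (coeff-there c m′ _ p λ eq →
        m′₋≢m (trans (cong (λ v → removeAt v i) eq) (removeAt-insertAt m i 0))))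

substZero-++ : ∀ {n} (i : Fin (suc n)) (p q : Poly (suc n)) →
               substZero i (p ++ q) ≡ substZero i p ++ substZero i q
substZero-++ i []             q = refl
substZero-++ i ((c , m) ∷ p) q with lookup m i
... | zero  = cong (_ ∷_) (substZero-++ i p q)
... | suc _ = substZero-++ i p q

substZero-term-* : ∀ {n} (i : Fin (suc n)) c (m : Mono (suc n)) q → lookup m i ≡ 0 →
  substZero i (((c , m) ∷ []) *ₚ q) ≡ ((c , removeAt m i) ∷ []) *ₚ substZero i q
substZero-term-* i c m []              mᵢ = refl
substZero-term-* i c m ((d , m′) ∷ q) mᵢ
  rewrite lookup-zipWith ℕ._+_ i m m′ | mᵢ | removeAt-zipWith ℕ._+_ m m′ i with lookup m′ i
... | zero  = cong (_ ∷_) (substZero-term-* i c m q mᵢ)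
... | suc _ = substZero-term-* i c m q mᵢ

substZero-term-*-tᵢ : ∀ {n} (i : Fin (suc n)) c (m : Mono (suc n)) q {k} → lookup m i ≡ suc k →
  substZero i (((c , m) ∷ []) *ₚ q) ≡ []
substZero-term-*-tᵢ i c m []              mᵢ = refl
substZero-term-*-tᵢ i c m ((d , m′) ∷ q) mᵢ rewrite lookup-zipWith ℕ._+_ i m m′ | mᵢ =
  substZero-term-*-tᵢ i c m q mᵢ

substZero-* : ∀ {n} (i : Fin (suc n)) (p q : Poly (suc n)) →
              substZero i (p *ₚ q) ≡ substZero i p *ₚ substZero i q
substZero-* i []             q = refl
substZero-* i ((c , m) ∷ p) q with lookup m i in mᵢ
... | zero = begin
  substZero i (((c , m) ∷ p) *ₚ q)                                  ≡⟨ cong (substZero i) (*-cons (c , m) p q) ⟩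
  substZero i (((c , m) ∷ []) *ₚ q ++ p *ₚ q)                       ≡⟨ substZero-++ i (((c , m) ∷ []) *ₚ q) _ ⟩
  substZero i (((c , m) ∷ []) *ₚ q) ++ substZero i (p *ₚ q)         ≡⟨ cong₂ _++_ (substZero-term-* i c m q mᵢ)
                                                                                   (substZero-* i p q) ⟩
  ((c , removeAt m i) ∷ []) *ₚ substZero i q ++ substZero i p *ₚ substZero i q
                                                                    ≡⟨ sym (*-cons (c , removeAt m i) (substZero i p) _) ⟩
  ((c , removeAt m i) ∷ substZero i p) *ₚ substZero i q             ∎
  where open ≡-Reasoning
... | suc k = begin
  substZero i (((c , m) ∷ p) *ₚ q)                                  ≡⟨ cong (substZero i) (*-cons (c , m) p q) ⟩
  substZero i (((c , m) ∷ []) *ₚ q ++ p *ₚ q)                       ≡⟨ substZero-++ i (((c , m) ∷ []) *ₚ q) _ ⟩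
  substZero i (((c , m) ∷ []) *ₚ q) ++ substZero i (p *ₚ q)         ≡⟨ cong₂ _++_ (substZero-term-*-tᵢ i c m q mᵢ)
                                                                                   (substZero-* i p q) ⟩
  substZero i p *ₚ substZero i q                                    ∎
  where open ≡-Reasoning

substZero-∂ : ∀ {n} (i : Fin (suc n)) (j : Fin n) (p : Poly (suc n)) →
              substZero i (∂ (punchIn i j) p) ≡ ∂ j (substZero i p)
substZero-∂ i j []             = refl
substZero-∂ i j ((c , m) ∷ p)
  rewrite lookup∘updateAt′ i (punchIn i j) {lower} (punchInᵢ≢i i j ∘ sym) m
        | removeAt-updateAt m i j lower
        | sym (lookup-removeAt m i j) with lookup m i
... | zero  = cong (_ ∷_) (substZero-∂ i j p)
... | suc _ = substZero-∂ i j p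

substZero-embedAt₀ : ∀ {n} (i : Fin (suc n)) (P : Poly (suc n)) →
                     substZero (suc i) (embedAt zero P) ≡ embedAt zero (substZero i P)
substZero-embedAt₀ i []                     = refl
substZero-embedAt₀ i ((c , m@(_ ∷ _)) ∷ P) with lookup m i
... | zero  = cong (_ ∷_) (substZero-embedAt₀ i P)
... | suc _ = substZero-embedAt₀ i P

-- The monomials of Ψ_G are t^(mono S)
-- for the spanning trees S, where mono S has exponent 0 on S and 1 off S.
-- indicator p m is 1 if m = mono S for some S with p S, and 0 otherwise.
indicator : ∀ {n} → (EdgeSet n → Bool) → Mono n → ℚ
indicator p []                = if p [] then 1ℚ else 0ℚ
indicator p (zero ∷ m)        = indicator (λ S → p (true ∷ S)) m
indicator p (suc zero ∷ m)    = indicator (λ S → p (false ∷ S)) m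
indicator p (suc (suc _) ∷ m) = 0ℚ

indicator-cong : ∀ {n} {p p′ : EdgeSet n → Bool} → (∀ S → p S ≡ p′ S) →
                 ∀ m → indicator p m ≡ indicator p′ m
indicator-cong p≗p′ []                = cong (λ b → if b then 1ℚ else 0ℚ) (p≗p′ [])
indicator-cong p≗p′ (zero ∷ m)        = indicator-cong (λ S → p≗p′ (true ∷ S)) m
indicator-cong p≗p′ (suc zero ∷ m)    = indicator-cong (λ S → p≗p′ (false ∷ S)) m
indicator-cong p≗p′ (suc (suc _) ∷ m) = refl

indicator-false : ∀ {n} (m : Mono n) → indicator (λ _ → false) m ≡ 0ℚ
indicator-false []                = refl
indicator-false (zero ∷ m)        = indicator-false m
indicator-false (suc zero ∷ m)    = indicator-false m
indicator-false (suc (suc _) ∷ m) = refl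

-- Exponent 0 at position i means that edge i belongs to S.
indicator-insertAt : ∀ {n} (p : EdgeSet (suc n) → Bool) (i : Fin (suc n)) (m : Mono n) →
                     indicator p (insertAt m i 0) ≡ indicator (λ S → p (insertAt S i true)) m
indicator-insertAt p zero    m                 = refl
indicator-insertAt p (suc i) (zero ∷ m)        = indicator-insertAt _ i m
indicator-insertAt p (suc i) (suc zero ∷ m)    = indicator-insertAt _ i m
indicator-insertAt p (suc i) (suc (suc _) ∷ m) = refl

exponent : Bool → ℕ
exponent b = if b then 0 else 1

module _ {n : ℕ} where

  termOf : EdgeSet n → ℚ × Mono n
  termOf S = (1ℚ , Vec.map exponent S)

  gather : (EdgeSet n → Bool) → List (EdgeSet n) → Poly n
  gather p X = List.map termOf (List.filter (λ S → T? (p S)) X)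

gather-++ : ∀ {n} (p : EdgeSet n → Bool) X Y m →
            coeff (gather p (X ++ Y)) m ≡ coeff (gather p X) m ℚ.+ coeff (gather p Y) m
gather-++ p X Y m = trans (cong (λ Z → coeff (List.map termOf Z) m) (LP.filter-++ (λ S → T? (p S)) X Y))
  (trans (cong (λ Z → coeff Z m) (LP.map-++ termOf (List.filter _ X) _))
         (coeff-++ (gather p X) (gather p Y) m))

gather-cons : ∀ {n} b (p : EdgeSet (suc n) → Bool) X m →
  coeff (gather p (List.map (b ∷_) X)) (exponent b ∷ m) ≡ coeff (gather (λ S → p (b ∷ S)) X) m
gather-cons b p []      m = refl
gather-cons b p (S ∷ X) m with p (b ∷ S)
... | false = gather-cons b p X m
... | true = step (≡-dec ℕ._≟_ (Vec.map exponent S) m)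
  where
    e = exponent b
    mS = Vec.map exponent S
    rest = gather p (List.map (b ∷_) X)
    rest′ = gather (λ S → p (b ∷ S)) X
    step : Dec (mS ≡ m) → coeff ((1ℚ , e ∷ mS) ∷ rest) (e ∷ m) ≡ coeff ((1ℚ , mS) ∷ rest′) m
    step (yes eq) = trans (coeff-here 1ℚ (e ∷ mS) (e ∷ m) rest (cong (e ∷_) eq))
                          (trans (cong (1ℚ ℚ.+_) (gather-cons b p X m)) (sym (coeff-here 1ℚ mS m rest′ eq)))
    step (no ne)  = trans (coeff-there 1ℚ (e ∷ mS) (e ∷ m) rest (ne ∘ proj₂ ∘ ∷-injective))
                          (trans (gather-cons b p X m) (sym (coeff-there 1ℚ mS m rest′ ne)))

gather-other : ∀ {n} b (p : EdgeSet (suc n) → Bool) X a m → a ≢ exponent b →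
  coeff (gather p (List.map (b ∷_) X)) (a ∷ m) ≡ 0ℚ
gather-other b p []      a m a≢ = refl
gather-other b p (S ∷ X) a m a≢ with p (b ∷ S)
... | false = gather-other b p X a m a≢
... | true  = trans (coeff-there 1ℚ (exponent b ∷ Vec.map exponent S) (a ∷ m) (gather p (List.map (b ∷_) X))
                           (a≢ ∘ sym ∘ proj₁ ∘ ∷-injective))
                    (gather-other b p X a m a≢)

gather-all : ∀ n (p : EdgeSet n → Bool) m → coeff (gather p (allEdgeSets n)) m ≡ indicator p m
gather-all zero    p [] with p []
... | true  = ℚP.+-identityʳ 1ℚ
... | false = refl
gather-all (suc n) p (a ∷ m) = trans (gather-++ p (List.map (true ∷_) X) (List.map (false ∷_) X) (a ∷ m)) (split a)
  where
    X = allEdgeSets n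
    split : ∀ a → coeff (gather p (List.map (true ∷_) X)) (a ∷ m) ℚ.+ coeff (gather p (List.map (false ∷_) X)) (a ∷ m)
                ≡ indicator p (a ∷ m)
    split zero          = trans (cong₂ ℚ._+_ (gather-cons true p X m) (gather-other false p X 0 m λ ()))
                                (trans (ℚP.+-identityʳ _) (gather-all n _ m))
    split (suc zero)    = trans (cong₂ ℚ._+_ (gather-other true p X 1 m λ ()) (gather-cons false p X m))
                                (trans (ℚP.+-identityˡ _) (gather-all n _ m))
    split (suc (suc k)) = trans (cong₂ ℚ._+_ (gather-other true p X _ m λ ()) (gather-other false p X _ m λ ()))
                                (ℚP.+-identityʳ _)

coeff-Ψ : ∀ {V E} (G : Graph V E) m → coeff (Ψ G) m ≡ indicator (isSpanningTree G) m
coeff-Ψ {E = E} G = gather-all E (isSpanningTree G)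

Ψ-contract : ∀ {k m} (M : Graph (suc k) (suc m)) (y : Fin (suc m))
             (nl : proj₂ (ends M y) ≢ proj₁ (ends M y)) → substZero y (Ψ M) ≈ₚ Ψ (M / y ⟨ nl ⟩)
Ψ-contract M y nl m = begin
  coeff (substZero y (Ψ M)) m                                   ≡⟨ coeff-substZero y (Ψ M) m ⟩
  coeff (Ψ M) (insertAt m y 0)                                  ≡⟨ coeff-Ψ M _ ⟩
  indicator (isSpanningTree M) (insertAt m y 0)                 ≡⟨ indicator-insertAt _ y m ⟩
  indicator (λ S → isSpanningTree M (insertAt S y true)) m
                                                ≡⟨ indicator-cong (Contraction.spanningTree-contract M y nl) m ⟩
  indicator (isSpanningTree (M / y ⟨ nl ⟩)) m                   ≡⟨ sym (coeff-Ψ (M / y ⟨ nl ⟩) m) ⟩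
  coeff (Ψ (M / y ⟨ nl ⟩)) m                                    ∎
  where open ≡-Reasoning

Ψ-multilinear : ∀ {V E} (G : Graph V (suc E)) k (r : Mono E) → coeff (Ψ G) (suc (suc k) ∷ r) ≡ 0ℚ
Ψ-multilinear G k r = coeff-Ψ G _

-- The graph K = G ∖ e of the theorem: the new vertex c = zero is joined only
-- by the edges x (index 0, to v₅) and y (index 1, to v₃), which are therefore
-- in series.  A spanning tree of K contains x or y, and exchanging x and y
-- preserves spanning trees.
module SeriesPair {V E : ℕ} (A : Graph V E) (v₃ v₄ v₅ : Fin V) where

  K : Graph (suc V) (2 + E)
  K = attach3 A v₃ v₄ v₅ ∖ edge-e

  -- With at least one of x, y selected, and every selected one ending at p,
  -- c is a leaf hanging off p, so connectivity of K is that of A.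
  module Leaf (s₀ s₁ : Bool) (S′ : EdgeSet E) (p : Fin V)
              (x↦p : T s₀ → v₅ ≡ p) (y↦p : T s₁ → v₃ ≡ p) (some : T s₀ ⊎ T s₁) where

    S : EdgeSet (2 + E)
    S = s₀ ∷ s₁ ∷ S′

    retract : Fin (suc V) → Fin V
    retract zero    = p
    retract (suc w) = w

    retract-edge : ∀ {u w} → Edge K S u w → Reach A S′ (retract u) (retract w)
    retract-edge (zero , s , inj₁ (refl , refl))        = subst (Reach A S′ p) (sym (x↦p s)) ε
    retract-edge (zero , s , inj₂ (refl , refl))        = subst (λ z → Reach A S′ z p) (sym (x↦p s)) ε
    retract-edge (suc zero , s , inj₁ (refl , refl))    = subst (Reach A S′ p) (sym (y↦p s)) ε
    retract-edge (suc zero , s , inj₂ (refl , refl))    = subst (λ z → Reach A S′ z p) (sym (y↦p s)) ε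
    retract-edge (suc (suc f) , s , inj₁ (refl , refl)) = (f , s , inj₁ (refl , refl)) ◅ ε
    retract-edge (suc (suc f) , s , inj₂ (refl , refl)) = (f , s , inj₂ (refl , refl)) ◅ ε

    retract-reach : ∀ {u w} → Reach K S u w → Reach A S′ (retract u) (retract w)
    retract-reach ε       = ε
    retract-reach (e ◅ r) = retract-edge e ◅◅ retract-reach r

    include : ∀ {u w} → Reach A S′ u w → Reach K S (suc u) (suc w)
    include ε                                = ε
    include ((f , s , inj₁ (refl , refl)) ◅ r) = (suc (suc f) , s , inj₁ (refl , refl)) ◅ include r
    include ((f , s , inj₂ (refl , refl)) ◅ r) = (suc (suc f) , s , inj₂ (refl , refl)) ◅ include r

    leaf : Reach K S zero (suc p)
    leaf = [ (λ s → subst (λ z → Reach K S zero (suc z)) (x↦p s) ((zero , s , inj₁ (refl , refl)) ◅ ε))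
           , (λ s → subst (λ z → Reach K S zero (suc z)) (y↦p s) ((suc zero , s , inj₁ (refl , refl)) ◅ ε))
           ]′ some

    conn-A : Conn K S → Conn A S′
    conn-A c u w = retract-reach (c (suc u) (suc w))

    conn-K : Conn A S′ → Conn K S
    conn-K c zero    zero    = ε
    conn-K c zero    (suc w) = leaf ◅◅ include (c p w)
    conn-K c (suc u) zero    = include (c u p) ◅◅ reach-sym K S leaf
    conn-K c (suc u) (suc w) = include (c u w)

  series-swap : ∀ S′ → isSpanningTree K (true ∷ false ∷ S′) ≡ isSpanningTree K (false ∷ true ∷ S′)
  series-swap S′ = spanningTree-≡ K _ K _ (viaY.conn-K ∘ viaX.conn-A) (viaX.conn-K ∘ viaY.conn-A) refl
    where
      module viaX = Leaf true false S′ v₅ (λ _ → refl) (λ ()) (inj₁ tt)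
      module viaY = Leaf false true S′ v₃ (λ ()) (λ _ → refl) (inj₂ tt)

  -- Without x and y the vertex c is isolated.
  series-neither : ∀ S′ → isSpanningTree K (false ∷ false ∷ S′) ≡ false
  series-neither S′ = cong (_∧ _) (T-ext (λ t → c-isolated (connectedOn⇒Conn K S t zero (suc v₃))) λ ())
    where
      S = false ∷ false ∷ S′
      stuck : ∀ {w} → Reach K S zero w → w ≡ zero
      stuck ε                                      = refl
      stuck ((zero , () , _) ◅ r)
      stuck ((suc zero , () , _) ◅ r)
      stuck ((suc (suc f) , s , inj₁ (() , _)) ◅ r)
      stuck ((suc (suc f) , s , inj₂ (() , _)) ◅ r)
      c-isolated : Reach K S zero (suc v₃) → ⊥
      c-isolated r with stuck r
      ... | ()

  -- In K, t_y := 0 in ∂Ψ_K/∂t_y gives ∂Ψ_{K/y}/∂t_x: the monomials of Ψ_K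
  -- with t_y-exponent 1 are those with t_x-exponent 0, swapped with x.
  series-∂ : (nl : proj₂ (ends K (suc zero)) ≢ proj₁ (ends K (suc zero))) →
             substZero (suc zero) (∂ (suc zero) (Ψ K)) ≈ₚ ∂ zero (Ψ (K / suc zero ⟨ nl ⟩))
  series-∂ nl (b ∷ r) = begin
    coeff (substZero (suc zero) (∂ (suc zero) (Ψ K))) (b ∷ r)
      ≡⟨ coeff-substZero (suc zero) (∂ (suc zero) (Ψ K)) (b ∷ r) ⟩
    coeff (∂ (suc zero) (Ψ K)) (b ∷ 0 ∷ r)
      ≡⟨ coeff-∂ (suc zero) (Ψ K) _ ⟩
    coeff (Ψ K) (b ∷ 1 ∷ r) ℚ.* fromℕ 1
      ≡⟨ exchange b ⟩
    coeff (Ψ K) (suc b ∷ 0 ∷ r) ℚ.* fromℕ (suc b)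
      ≡⟨ cong (ℚ._* _) (sym (coeff-substZero (suc zero) (Ψ K) _)) ⟩
    coeff (substZero (suc zero) (Ψ K)) (suc b ∷ r) ℚ.* fromℕ (suc b)
      ≡⟨ cong (ℚ._* _) (Ψ-contract K (suc zero) nl _) ⟩
    coeff (Ψ (K / suc zero ⟨ nl ⟩)) (suc b ∷ r) ℚ.* fromℕ (suc b)
      ≡⟨ sym (coeff-∂ zero (Ψ (K / suc zero ⟨ nl ⟩)) _) ⟩
    coeff (∂ zero (Ψ (K / suc zero ⟨ nl ⟩))) (b ∷ r) ∎
    where
      open ≡-Reasoning
      -- b = 0: swap x and y; b = 1: no tree omits both; b ≥ 2: Ψ is multilinear
      exchange : ∀ b → coeff (Ψ K) (b ∷ 1 ∷ r) ℚ.* fromℕ 1 ≡ coeff (Ψ K) (suc b ∷ 0 ∷ r) ℚ.* fromℕ (suc b)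
      exchange zero = cong (ℚ._* fromℕ 1)
        (trans (coeff-Ψ K _) (trans (indicator-cong series-swap r) (sym (coeff-Ψ K _))))
      exchange (suc zero) = begin
        coeff (Ψ K) (1 ∷ 1 ∷ r) ℚ.* fromℕ 1       ≡⟨ cong (ℚ._* fromℕ 1) (trans (coeff-Ψ K _)
                                                     (trans (indicator-cong series-neither r) (indicator-false r))) ⟩
        0ℚ ℚ.* fromℕ 1                          ≡⟨ ℚP.*-zeroˡ (fromℕ 1) ⟩
        0ℚ                                        ≡⟨ sym (ℚP.*-zeroˡ (fromℕ 2)) ⟩
        0ℚ ℚ.* fromℕ 2                          ≡⟨ cong (ℚ._* fromℕ 2) (sym (Ψ-multilinear K 0 (0 ∷ r))) ⟩
        coeff (Ψ K) (2 ∷ 0 ∷ r) ℚ.* fromℕ 2       ∎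
      exchange (suc (suc k)) = trans (cong (ℚ._* fromℕ 1) (Ψ-multilinear K k (1 ∷ r)))
        (trans (ℚP.*-zeroˡ (fromℕ 1)) (trans (sym (ℚP.*-zeroˡ (fromℕ (3 + k))))
               (cong (ℚ._* fromℕ (3 + k)) (sym (Ψ-multilinear K (suc k) (0 ∷ r))))))

sum-merge : ∀ {n} (a : Fin (3 + n) → ℚ) (b : Fin (2 + n) → ℚ) →
  a zero ≡ b zero → a (suc zero) ℚ.+ a (suc (suc zero)) ≡ b (suc zero) →
  (∀ j → a (suc (suc (suc j))) ≡ b (suc (suc j))) → sum a ≡ sum b
sum-merge a b first middle rest = cong₂ ℚ._+_ first
  (trans (sym (ℚP.+-assoc (a (suc zero)) (a (suc (suc zero))) _)) (cong₂ ℚ._+_ middle (sum-cong-≗ rest)))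

module Theorem6 {V E : ℕ} (A : Graph V E) (v₃ v₄ v₅ : Fin V)
                (nl : proj₂ (ends (attach3 A v₃ v₄ v₅) edge-y) ≢ proj₁ (ends (attach3 A v₃ v₄ v₅) edge-y)) where

  open SeriesPair A v₃ v₄ v₅ using (K; series-∂)

  G : Graph (suc V) (3 + E)
  G = attach3 A v₃ v₄ v₅

  H : Graph V (2 + E)
  H = G / edge-y ⟨ nl ⟩

  e′ : Fin (2 + E)
  e′ = punchOut {i = edge-y {E}} {j = edge-e} (λ ())

  -- H ∖ e′ is, definitionally, K / y.
  L : Graph V (1 + E)
  L = H ∖ e′

  g : Fin (3 + E) → Poly (3 + E)
  g f = ∂ f (embedAt edge-e (Ψ K))

  h : Fin (2 + E) → Poly (2 + E)
  h j = ∂ j (embedAt e′ (Ψ L))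

  Ψ-K₀ : embedAt zero (substZero (suc zero) (Ψ K)) ≈ₚ embedAt zero (Ψ L)
  Ψ-K₀ = embedAt-cong zero (substZero (suc zero) (Ψ K)) (Ψ L) (Ψ-contract K (suc zero) nl)

  generator : ∀ j → substZero edge-y (g (punchIn edge-y j)) ≈ₚ h j
  generator j m = begin
    coeff (substZero edge-y (g (punchIn edge-y j))) m
      ≡⟨ cong (λ P → coeff P m) (substZero-∂ edge-y j (embedAt zero (Ψ K))) ⟩
    coeff (∂ j (substZero edge-y (embedAt zero (Ψ K)))) m
      ≡⟨ cong (λ P → coeff (∂ j P) m) (substZero-embedAt₀ (suc zero) (Ψ K)) ⟩
    coeff (∂ j (embedAt zero (substZero (suc zero) (Ψ K)))) m
      ≡⟨ ∂-cong j (embedAt zero (substZero (suc zero) (Ψ K))) (embedAt zero (Ψ L)) Ψ-K₀ m ⟩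
    coeff (h j) m ∎
    where open ≡-Reasoning

  generator-y : substZero edge-y (g edge-y) ≈ₚ h (suc zero)
  generator-y m = begin
    coeff (substZero edge-y (g edge-y)) m
      ≡⟨ cong (λ P → coeff (substZero edge-y P) m) (∂-embedAt₀ (suc zero) (Ψ K)) ⟩
    coeff (substZero edge-y (embedAt zero (∂ (suc zero) (Ψ K)))) m
      ≡⟨ cong (λ P → coeff P m) (substZero-embedAt₀ (suc zero) (∂ (suc zero) (Ψ K))) ⟩
    coeff (embedAt zero (substZero (suc zero) (∂ (suc zero) (Ψ K)))) m
      ≡⟨ embedAt-cong zero (substZero (suc zero) (∂ (suc zero) (Ψ K))) (∂ zero (Ψ L)) (series-∂ nl) m ⟩
    coeff (embedAt zero (∂ zero (Ψ L))) m
      ≡⟨ cong (λ P → coeff P m) (sym (∂-embedAt₀ zero (Ψ L))) ⟩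
    coeff (h (suc zero)) m ∎
    where open ≡-Reasoning

  transfer : Cond1 G edge-e → Cond1 H e′
  transfer (q , Ψ≈) = q′ , certificate
    where
      -- substitute t_y := 0 in the cofactors, merging those of ∂_x and ∂_y
      q′ : Fin (2 + E) → Poly (2 + E)
      q′ zero          = substZero edge-y (q zero)
      q′ (suc zero)    = substZero edge-y (q (suc zero)) ++ substZero edge-y (q edge-y)
      q′ (suc (suc j)) = substZero edge-y (q (suc (suc (suc j))))

      certificate : Ψ H ≈ₚ Σₚ (λ j → q′ j *ₚ h j)
      certificate m = begin
        coeff (Ψ H) m
          ≡⟨ sym (Ψ-contract G edge-y nl m) ⟩
        coeff (substZero edge-y (Ψ G)) m
          ≡⟨ coeff-substZero edge-y (Ψ G) m ⟩
        coeff (Ψ G) (insertAt m edge-y 0)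
          ≡⟨ Ψ≈ _ ⟩
        coeff (Σₚ (λ f → q f *ₚ g f)) (insertAt m edge-y 0)
          ≡⟨ coeff-Σ (λ f → q f *ₚ g f) _ ⟩
        sum (λ f → coeff (q f *ₚ g f) (insertAt m edge-y 0))
          ≡⟨ sum-cong-≗ (λ f → sym (coeff-substZero edge-y (q f *ₚ g f) m)) ⟩
        sum (λ f → coeff (substZero edge-y (q f *ₚ g f)) m)
          ≡⟨ regroup ⟩
        sum (λ j → coeff (q′ j *ₚ h j) m)
          ≡⟨ sym (coeff-Σ (λ j → q′ j *ₚ h j) m) ⟩
        coeff (Σₚ (λ j → q′ j *ₚ h j)) m ∎
        where
          open ≡-Reasoning
          image : ∀ f {j} → substZero edge-y (g f) ≈ₚ h j →
                  coeff (substZero edge-y (q f *ₚ g f)) m ≡ coeff (substZero edge-y (q f) *ₚ h j) m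
          image f gen = trans (cong (λ P → coeff P m) (substZero-* edge-y (q f) (g f)))
                              (*-congˡ (substZero edge-y (q f)) gen m)
          -- the summands for x and y both land on the generator for x
          merged : coeff (substZero edge-y (q (suc zero) *ₚ g (suc zero))) m
                   ℚ.+ coeff (substZero edge-y (q edge-y *ₚ g edge-y)) m ≡ coeff (q′ (suc zero) *ₚ h (suc zero)) m
          merged = trans (cong₂ ℚ._+_ (image (suc zero) (generator (suc zero))) (image edge-y generator-y))
            (sym (trans (cong (λ P → coeff P m) (*-distribʳ-++ (substZero edge-y (q (suc zero))) _ (h (suc zero))))
                        (coeff-++ (substZero edge-y (q (suc zero)) *ₚ h (suc zero)) _ m)))
          regroup : sum (λ f → coeff (substZero edge-y (q f *ₚ g f)) m) ≡ sum (λ j → coeff (q′ j *ₚ h j) m)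
          regroup = sum-merge (λ f → coeff (substZero edge-y (q f *ₚ g f)) m) (λ j → coeff (q′ j *ₚ h j) m)
            (image zero (generator zero)) merged (λ j → image (suc (suc (suc j))) (generator (suc (suc j))))

mainTheorem6 : ∀ {V E : ℕ} (A : Graph V E) (v₃ v₄ v₅ : Fin V) →
    v₃ ≢ v₄ → v₄ ≢ v₅ → v₃ ≢ v₅ →
    Connected (attach3 A v₃ v₄ v₅) →
    Cond1 (attach3 A v₃ v₄ v₅) edge-e →
    Cond1 (attach3 A v₃ v₄ v₅ / edge-y ⟨ (λ ()) ⟩)
          (punchOut {i = edge-y {E}} {j = edge-e} (λ ()))
mainTheorem6 A v₃ v₄ v₅ _ _ _ _ = Theorem6.transfer A v₃ v₄ v₅ _
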